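{- Let $\mathbf E=(E,+,{}',0,1)$ be a lattice effect algebra with induced order $\leq$ and lattice operations $\vee,\wedge$, and put $x\rightarrow y:=y+(x\vee y)'$ for all $x,y\in E$. Then $(E,\rightarrow,0)$ is a lattice effect implication algebra, and for all $x,y\in E$: $x\leq y$ if and only if $x\rightarrow y=1$; $x\vee y=(x\rightarrow y)\rightarrow y$; and $x\wedge y=(x'\vee y')'$.
   Context: An effect algebra is a structure $(E,+,{}',0,1)$ where $E$ is a set, ${}'$ is a unary operation on $E$, $0,1\in E$, and $+$ is a partial binary operation on $E$ such that for all $x,y,z\in E$: (E1) if $x+y$ is defined then so is $y+x$ and $x+y=y+x$; (E2) $(x+y)+z$ is defined if and only if $x+(y+z)$ is defined, and then they are equal; (E3) $x+y$ is defined and equals $1$ if and only if $y=x'$; (E4) if $1+x$ is defined then $x=0$. The induced order is $x\leq y$ iff there exists $z$ with $x+z=y$. A lattice effect algebra is an effect algebra whose induced order is a lattice order. A lattice effect implication algebra is an algebra $(I,\rightarrow,0)$ with a binary operation $\rightarrow$ and a constant $0$ such that, writing $x':=x\rightarrow0$ and $1:=0'$, for all $x,y,z\in I$: (i) $0\rightarrow x=x\rightarrow x=x\rightarrow1=1$; (ii) if $x\rightarrow y=y\rightarrow x=1$ then $x=y$; (iii) if $x\rightarrow y=y\rightarrow z=1$ then $x\rightarrow z=1$; (iv) if $x\rightarrow y=1$ then $y'\rightarrow x'=1$; (v) $x''=x$; (vi) $x\rightarrow((x\rightarrow y)\rightarrow y)=1$; (vii) $y\rightarrow((x\rightarrow y)\rightarrow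 y)=1$; (viii) if $x\rightarrow z=y\rightarrow z=1$ then $((x\rightarrow y)\rightarrow y)\rightarrow z=1$; (ix) if $x\rightarrow y=1$ then $y\rightarrow x=x'\rightarrow y'$; (x) [$x\rightarrow y'=1$ and $(x'\rightarrow y)\rightarrow z'=1$] if and only if [$y\rightarrow z'=1$ and $x\rightarrow(y'\rightarrow z)'=1$], and in this case $(x'\rightarrow y)'\rightarrow z=x'\rightarrow(y'\rightarrow z)$; (xi) $y'\rightarrow((x\rightarrow y)\rightarrow y)'=x\rightarrow y$; (xii) $x\rightarrow(y\rightarrow x)=1$. -}

module Defs where

open import Data.Maybe using (Maybe; just; nothing; _>>=_)
open import Data.Product using (Σ; ∃; _×_; _,_)
open import Relation.Binary.PropositionalEquality using (_≡_)

-- Effect algebra (E, +, ′, 0, 1); the partial operation + is modelled as a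
-- total function into Maybe E (nothing = undefined).
record EffectAlgebra : Set₁ where
  infixl 6 _⊕_
  field
    E   : Set
    _⊕_ : E → E → Maybe E
    _′  : E → E
    𝟘   : E
    𝟙   : E
    comm  : ∀ x y z → x ⊕ y ≡ just z → y ⊕ x ≡ just z
    -- (E2): (x+y)+z defined iff x+(y+z) defined, and then equal
    assoc : ∀ x y z → (x ⊕ y >>= λ u → u ⊕ z) ≡ (y ⊕ z >>= λ v → x ⊕ v)
    orthoˡ : ∀ x y → x ⊕ y ≡ just 𝟙 → y ≡ x ′
    orthoʳ : ∀ x y → y ≡ x ′ → x ⊕ y ≡ just 𝟙
    zero-one : ∀ x z → 𝟙 ⊕ x ≡ just z → x ≡ 𝟘

  _≤_ : E → E → Set
  x ≤ y = ∃ λ z → x ⊕ z ≡ just y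

record LatticeEffectAlgebra : Set₁ where
  field
    effectAlgebra : EffectAlgebra
  open EffectAlgebra effectAlgebra public
  field
    _∨_ : E → E → E
    _∧_ : E → E → E
    ∨-upperˡ : ∀ x y → x ≤ (x ∨ y)
    ∨-upperʳ : ∀ x y → y ≤ (x ∨ y)
    ∨-least  : ∀ x y z → x ≤ z → y ≤ z → (x ∨ y) ≤ z
    ∧-lowerˡ : ∀ x y → (x ∧ y) ≤ x
    ∧-lowerʳ : ∀ x y → (x ∧ y) ≤ y
    ∧-greatest : ∀ x y z → z ≤ x → z ≤ y → z ≤ (x ∧ y)

record IsLEIA (I : Set) (_⇒_ : I → I → I) (o : I) : Set where
  private
    _′ : I → I
    x ′ = x ⇒ o
    one : I
    one = o ′
  field
    i-a   : ∀ x → o ⇒ x ≡ one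
    i-b   : ∀ x → x ⇒ x ≡ one
    i-c   : ∀ x → x ⇒ one ≡ one
    ii    : ∀ x y → x ⇒ y ≡ one → y ⇒ x ≡ one → x ≡ y
    iii   : ∀ x y z → x ⇒ y ≡ one → y ⇒ z ≡ one → x ⇒ z ≡ one
    iv    : ∀ x y → x ⇒ y ≡ one → (y ′) ⇒ (x ′) ≡ one
    v     : ∀ x → (x ′) ′ ≡ x
    vi    : ∀ x y → x ⇒ ((x ⇒ y) ⇒ y) ≡ one
    vii   : ∀ x y → y ⇒ ((x ⇒ y) ⇒ y) ≡ one
    viii  : ∀ x y z → x ⇒ z ≡ one → y ⇒ z ≡ one → ((x ⇒ y) ⇒ y) ⇒ z ≡ one
    ix    : ∀ x y → x ⇒ y ≡ one → y ⇒ x ≡ (x ′) ⇒ (y ′)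
    x-to  : ∀ x y z → (x ⇒ (y ′) ≡ one) × (((x ′) ⇒ y) ⇒ (z ′) ≡ one)
                    → (y ⇒ (z ′) ≡ one) × (x ⇒ (((y ′) ⇒ z) ′) ≡ one)
    x-from : ∀ x y z → (y ⇒ (z ′) ≡ one) × (x ⇒ (((y ′) ⇒ z) ′) ≡ one)
                    → (x ⇒ (y ′) ≡ one) × (((x ′) ⇒ y) ⇒ (z ′) ≡ one)
    x-eq  : ∀ x y z → (x ⇒ (y ′) ≡ one) × (((x ′) ⇒ y) ⇒ (z ′) ≡ one)
                    → (((x ′) ⇒ y) ′) ⇒ z ≡ (x ′) ⇒ ((y ′) ⇒ z)
    xi    : ∀ x y → (y ′) ⇒ (((x ⇒ y) ⇒ y) ′) ≡ x ⇒ y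
    xii   : ∀ x y → x ⇒ (y ⇒ x) ≡ one

-- For comparable arguments the implication x ⇒ y = y ⊕ (x ∨ y)′ is expressed by
-- the effect-algebra sum itself: if a ≤ b then b ⇒ a = a ⊕ b′, and if x ⊥ y then
-- x ⊕ y = x′ ⇒ y. The first identity gives x ⇒ 𝟘 = x′, (x ⇒ y = 𝟙 iff x ≤ y)
-- and (x ⇒ y) ⇒ y = x ∨ y, which turn all axioms except (x) into facts about a
-- poset with an antitone involution; the second turns axiom (x) into the
-- associativity (E2) of ⊕.
module Submission where

open import Defs
open import Data.Maybe using (Maybe; just; _>>=_)
open import Data.Maybe.Properties using (just-injective)
open import Data.Product using (Σ; ∃; _×_; _,_; proj₁; proj₂; map)
open import Relation.Binary.PropositionalEquality
open import Function.Bundles using (_⇔_; mk⇔; Equivalence)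

≡just-unique : ∀ {A : Set} {m : Maybe A} {x y : A} → m ≡ just x → m ≡ just y → x ≡ y
≡just-unique p q = just-injective (trans (sym p) q)

>>=≡just : ∀ {A B : Set} {t : B} (m : Maybe A) (f : A → Maybe B) →
           (m >>= f) ≡ just t → ∃ λ v → m ≡ just v × f v ≡ just t
>>=≡just (just v) f p = v , refl , p

module EffectAlgebraProperties (𝔼 : EffectAlgebra) where
  open EffectAlgebra 𝔼

  variable
    a b c d u v w x y z : E

  infix 4 _⊥_

  _⊥_ : E → E → Set
  x ⊥ y = ∃ λ z → x ⊕ y ≡ just z

  ⊕-comm : x ⊕ y ≡ just z → y ⊕ x ≡ just z
  ⊕-comm = comm _ _ _

  ⊕-assocʳ : x ⊕ y ≡ just u → u ⊕ z ≡ just w → ∃ λ v → y ⊕ z ≡ just v × x ⊕ v ≡ just w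
  ⊕-assocʳ {x} {y} {u} {z} {w} xy uz = >>=≡just (y ⊕ z) (x ⊕_) (begin
    (y ⊕ z >>= x ⊕_)              ≡⟨ assoc x y z ⟨
    (x ⊕ y >>= λ u → u ⊕ z)      ≡⟨ cong (_>>= λ u → u ⊕ z) xy ⟩
    u ⊕ z                         ≡⟨ uz ⟩
    just w                        ∎)
    where open ≡-Reasoning

  ⊕-assocˡ : y ⊕ z ≡ just v → x ⊕ v ≡ just w → ∃ λ u → x ⊕ y ≡ just u × u ⊕ z ≡ just w
  ⊕-assocˡ yz xv with ⊕-assocʳ (⊕-comm yz) (⊕-comm xv)
  ... | u , yx , uz = u , ⊕-comm yx , ⊕-comm uz

  ⊕-′ : ∀ x → x ⊕ x ′ ≡ just 𝟙
  ⊕-′ x = orthoʳ x (x ′) refl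

  ′-unique : x ⊕ y ≡ just 𝟙 → y ≡ x ′
  ′-unique = orthoˡ _ _

  ′-involutive : ∀ x → x ′ ′ ≡ x
  ′-involutive x = sym (′-unique (⊕-comm (⊕-′ x)))

  ′-injective : x ′ ≡ y ′ → x ≡ y
  ′-injective {x} {y} p = begin
    x      ≡⟨ ′-involutive x ⟨
    x ′ ′  ≡⟨ cong _′ p ⟩
    y ′ ′  ≡⟨ ′-involutive y ⟩
    y      ∎
    where open ≡-Reasoning

  𝟙′≡𝟘 : 𝟙 ′ ≡ 𝟘
  𝟙′≡𝟘 = zero-one (𝟙 ′) 𝟙 (⊕-′ 𝟙)

  ⊕-identityʳ : ∀ x → x ⊕ 𝟘 ≡ just x
  ⊕-identityʳ x with ⊕-assocʳ (⊕-′ (x ′)) (orthoʳ 𝟙 𝟘 (sym 𝟙′≡𝟘))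
  ... | v , x′′⊕𝟘 , x′⊕v = subst (λ t → t ⊕ 𝟘 ≡ just t) (′-involutive x)
    (subst (λ t → x ′ ′ ⊕ 𝟘 ≡ just t) (′-unique x′⊕v) x′′⊕𝟘)

  ⊕-identityˡ : ∀ x → 𝟘 ⊕ x ≡ just x
  ⊕-identityˡ x = ⊕-comm (⊕-identityʳ x)

  ⊕-cancelˡ : x ⊕ y ≡ just a → x ⊕ z ≡ just a → y ≡ z
  ⊕-cancelˡ {a = a} xy xz with ⊕-assocʳ (⊕-comm xy) (⊕-′ a) | ⊕-assocʳ (⊕-comm xz) (⊕-′ a)
  ... | v , xa′ , yv | w , xa′′ , zw =
    ′-injective (trans (sym (′-unique yv)) (trans (≡just-unique xa′ xa′′) (′-unique zw)))

  ⊕≡𝟘⇒≡𝟘 : x ⊕ y ≡ just 𝟘 → y ≡ 𝟘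
  ⊕≡𝟘⇒≡𝟘 xy with ⊕-assocʳ xy (⊕-identityˡ 𝟙)
  ... | v , y𝟙 , _ = zero-one _ v (⊕-comm y𝟙)

  ≤-refl : x ≤ x
  ≤-refl = 𝟘 , ⊕-identityʳ _

  ≤-trans : x ≤ y → y ≤ z → x ≤ z
  ≤-trans (_ , xy) (_ , yz) with ⊕-assocʳ xy yz
  ... | v , _ , xv = v , xv

  -- x ⊕ (d ⊕ e) = x = x ⊕ 𝟘 forces d ⊕ e = 𝟘, hence d = 𝟘.
  ≤-antisym : x ≤ y → y ≤ x → x ≡ y
  ≤-antisym {x} (d , xd) (e , ye) with ⊕-assocʳ xd ye
  ... | v , de , xv = ≡just-unique (⊕-identityʳ x) (subst (λ t → x ⊕ t ≡ just _) d≡𝟘 xd)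
    where
    d≡𝟘 : d ≡ 𝟘
    d≡𝟘 = ⊕≡𝟘⇒≡𝟘 (⊕-comm (subst (λ t → d ⊕ e ≡ just t) (⊕-cancelˡ xv (⊕-identityʳ x)) de))

  𝟘≤ : ∀ x → 𝟘 ≤ x
  𝟘≤ x = x , ⊕-identityˡ x

  ≤𝟙 : ∀ x → x ≤ 𝟙
  ≤𝟙 x = x ′ , ⊕-′ x

  ≤⇒⊥′ : x ≤ y → x ⊥ y ′
  ≤⇒⊥′ {y = y} (_ , xy) with ⊕-assocʳ (⊕-comm xy) (⊕-′ y)
  ... | v , xy′ , _ = v , xy′

  ⊥′⇒≤ : x ⊥ y ′ → x ≤ y
  ⊥′⇒≤ {y = y} (w , xy′) with ⊕-assocʳ xy′ (⊕-′ w)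
  ... | v , y′w′ , xv with ⊕-assocˡ (⊕-comm y′w′) xv
  ... | u , xw′ , uy′ = w ′ , subst (λ t → _ ⊕ w ′ ≡ just t) (′-injective (sym (′-unique uy′))) xw′

  ⊥⇒≤′ : x ⊥ y → x ≤ (y ′)
  ⊥⇒≤′ {y = y} (w , xy) = ⊥′⇒≤ (w , subst (λ t → _ ⊕ t ≡ just w) (sym (′-involutive y)) xy)

  ≤′⇒⊥ : x ≤ (y ′) → x ⊥ y
  ≤′⇒⊥ {y = y} x≤y′ with ≤⇒⊥′ x≤y′
  ... | w , xy′′ = w , subst (λ t → _ ⊕ t ≡ just w) (′-involutive y) xy′′

  ′-antitone : x ≤ y → (y ′) ≤ (x ′)
  ′-antitone x≤y with ≤⇒⊥′ x≤y
  ... | w , xy′ = ⊥⇒≤′ (w , ⊕-comm xy′)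

  ≤′-swap : x ≤ (y ′) → y ≤ (x ′)
  ≤′-swap {y = y} x≤y′ = subst (_≤ _) (′-involutive y) (′-antitone x≤y′)

  ⊕-difference : a ⊕ d ≡ just b → a ⊕ b ′ ≡ just w → d ≡ w ′
  ⊕-difference {d = d} {b = b} ad ab′ with ⊕-assocʳ (⊕-comm ad) (⊕-′ b)
  ... | v , ab′′ , dv = subst (λ t → d ≡ t ′) (≡just-unique ab′′ ab′) (′-unique (⊕-comm dv))

module LatticeEffectAlgebraProperties (L : LatticeEffectAlgebra) where
  open LatticeEffectAlgebra L
  open EffectAlgebraProperties effectAlgebra

  ∨-absorbs-≤ˡ : a ≤ b → a ∨ b ≡ b
  ∨-absorbs-≤ˡ {a} {b} a≤b = ≤-antisym (∨-least a b b a≤b ≤-refl) (∨-upperʳ a b)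

  ∨-absorbs-≤ʳ : a ≤ b → b ∨ a ≡ b
  ∨-absorbs-≤ʳ {a} {b} a≤b = ≤-antisym (∨-least b a b ≤-refl a≤b) (∨-upperˡ b a)

  ∧≡′∨′ : ∀ x y → x ∧ y ≡ ((x ′) ∨ (y ′)) ′
  ∧≡′∨′ x y = ≤-antisym
    (subst (_≤ (((x ′) ∨ (y ′)) ′)) (′-involutive (x ∧ y))
      (′-antitone (∨-least (x ′) (y ′) _ (′-antitone (∧-lowerˡ x y)) (′-antitone (∧-lowerʳ x y)))))
    (∧-greatest x y _ (below (∨-upperˡ (x ′) (y ′))) (below (∨-upperʳ (x ′) (y ′))))
    where
    below : ∀ {t} → (t ′) ≤ ((x ′) ∨ (y ′)) → (((x ′) ∨ (y ′)) ′) ≤ t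
    below {t} p = subst (_ ≤_) (′-involutive t) (′-antitone p)

  infixr 5 _⇒_

  -- Opaque, so that _⇒_ is known only through ⇒-sum: its witness mentions
  -- ∨-upperʳ x y, which a with-abstraction over that proof would otherwise capture.
  opaque
    _⇒_ : E → E → E
    x ⇒ y = proj₁ (≤⇒⊥′ (∨-upperʳ x y))

    ⇒-sum : ∀ x y → y ⊕ (x ∨ y) ′ ≡ just (x ⇒ y)
    ⇒-sum x y = proj₂ (≤⇒⊥′ (∨-upperʳ x y))

  ≤⇒⊕′≡⇒ : a ≤ b → a ⊕ b ′ ≡ just (b ⇒ a)
  ≤⇒⊕′≡⇒ {a} {b} a≤b = subst (λ t → a ⊕ t ′ ≡ just (b ⇒ a)) (∨-absorbs-≤ʳ a≤b) (⇒-sum b a)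

  ≤′⇒⊕≡⇒ : x ≤ (y ′) → x ⊕ y ≡ just (x ′ ⇒ y)
  ≤′⇒⊕≡⇒ {x} {y} x≤y′ =
    ⊕-comm (subst (λ t → y ⊕ t ≡ just (x ′ ⇒ y)) (′-involutive x) (≤⇒⊕′≡⇒ (≤′-swap x≤y′)))

  ⊕≡⇒ : x ⊕ y ≡ just w → w ≡ x ′ ⇒ y
  ⊕≡⇒ xy = ≡just-unique xy (≤′⇒⊕≡⇒ (⊥⇒≤′ (_ , xy)))

  ⇒≡𝟙⇒≤ : x ⇒ y ≡ 𝟙 → x ≤ y
  ⇒≡𝟙⇒≤ {x} {y} x⇒y≡𝟙 = subst (x ≤_) x∨y≡y (∨-upperˡ x y)
    where
    x∨y≡y : x ∨ y ≡ y
    x∨y≡y = ′-injective (′-unique (subst (λ t → y ⊕ ((x ∨ y) ′) ≡ just t) x⇒y≡𝟙 (⇒-sum x y)))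

  ≤⇒⇒≡𝟙 : x ≤ y → x ⇒ y ≡ 𝟙
  ≤⇒⇒≡𝟙 {x} {y} x≤y =
    ≡just-unique (subst (λ t → y ⊕ t ′ ≡ just (x ⇒ y)) (∨-absorbs-≤ˡ x≤y) (⇒-sum x y)) (⊕-′ y)

  ⇒𝟘 : ∀ x → x ⇒ 𝟘 ≡ x ′
  ⇒𝟘 x = ≡just-unique (≤⇒⊕′≡⇒ (𝟘≤ x)) (⊕-identityˡ (x ′))

  ⇒⇒≡∨ : ∀ x y → (x ⇒ y) ⇒ y ≡ x ∨ y
  ⇒⇒≡∨ x y = ≡just-unique (≤⇒⊕′≡⇒ (_ , ⇒-sum x y)) y⊕[x⇒y]′
    where
    y⊕[x⇒y]′ : y ⊕ (x ⇒ y) ′ ≡ just (x ∨ y)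
    y⊕[x⇒y]′ with ∨-upperʳ x y
    ... | d , yd = subst (λ t → y ⊕ t ≡ just (x ∨ y)) (⊕-difference yd (⇒-sum x y)) yd

  ≤′-assocʳ : x ≤ (y ′) → (x ′ ⇒ y) ≤ (z ′) → y ≤ (z ′) × x ≤ ((y ′ ⇒ z) ′)
  ≤′-assocʳ {x} {y} {z} x≤y′ s≤z′ = go (⊕-assocʳ (≤′⇒⊕≡⇒ x≤y′) (proj₂ (≤′⇒⊥ s≤z′)))
    where
    go : ∀ {t} → (∃ λ v → y ⊕ z ≡ just v × x ⊕ v ≡ just t) → y ≤ (z ′) × x ≤ ((y ′ ⇒ z) ′)
    go (v , yz , xv) = ⊥⇒≤′ (v , yz) , subst (λ t → x ≤ (t ′)) (⊕≡⇒ yz) (⊥⇒≤′ (_ , xv))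

  ≤′-assocˡ : y ≤ (z ′) → x ≤ ((y ′ ⇒ z) ′) → x ≤ (y ′) × (x ′ ⇒ y) ≤ (z ′)
  ≤′-assocˡ {y} {z} {x} y≤z′ x≤s′ = go (⊕-assocˡ (≤′⇒⊕≡⇒ y≤z′) (proj₂ (≤′⇒⊥ x≤s′)))
    where
    go : ∀ {t} → (∃ λ u → x ⊕ y ≡ just u × u ⊕ z ≡ just t) → x ≤ (y ′) × (x ′ ⇒ y) ≤ (z ′)
    go (u , xy , uz) = ⊥⇒≤′ (u , xy) , subst (_≤ (z ′)) (⊕≡⇒ xy) (⊥⇒≤′ (_ , uz))

  ≤⇒⇒≡′⇒′ : x ≤ y → y ⇒ x ≡ x ′ ⇒ y ′
  ≤⇒⇒≡′⇒′ {x} {y} x≤y =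
    ≡just-unique (≤⇒⊕′≡⇒ x≤y) (≤′⇒⊕≡⇒ (subst (x ≤_) (sym (′-involutive y)) x≤y))

  ⇒-assoc : x ≤ (y ′) → (x ′ ⇒ y) ≤ (z ′) → (x ′ ⇒ y) ′ ⇒ z ≡ x ′ ⇒ (y ′ ⇒ z)
  ⇒-assoc {x} {y} {z} x≤y′ s≤z′ = go (proj₂ (≤′⇒⊥ s≤z′))
    where
    go : ∀ {t} → (x ′ ⇒ y) ⊕ z ≡ just t → (x ′ ⇒ y) ′ ⇒ z ≡ x ′ ⇒ (y ′ ⇒ z)
    go {t} sz = summands (⊕-assocʳ (≤′⇒⊕≡⇒ x≤y′) sz)
      where
      open ≡-Reasoning
      summands : (∃ λ v → y ⊕ z ≡ just v × x ⊕ v ≡ just t) → (x ′ ⇒ y) ′ ⇒ z ≡ x ′ ⇒ (y ′ ⇒ z)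
      summands (v , yz , xv) = begin
        (x ′ ⇒ y) ′ ⇒ z  ≡⟨ ⊕≡⇒ sz ⟨
        t                ≡⟨ ⊕≡⇒ xv ⟩
        x ′ ⇒ v          ≡⟨ cong (x ′ ⇒_) (⊕≡⇒ yz) ⟩
        x ′ ⇒ (y ′ ⇒ z)  ∎

  𝟘⇒𝟘≡𝟙 : 𝟘 ⇒ 𝟘 ≡ 𝟙
  𝟘⇒𝟘≡𝟙 = ≤⇒⇒≡𝟙 ≤-refl

  ⇒≡𝟘⇒𝟘⇔≤ : a ≡ c → b ≡ d → (a ⇒ b ≡ 𝟘 ⇒ 𝟘) ⇔ (c ≤ d)
  ⇒≡𝟘⇒𝟘⇔≤ refl refl = mk⇔ (λ p → ⇒≡𝟙⇒≤ (trans p 𝟘⇒𝟘≡𝟙)) (λ a≤b → trans (≤⇒⇒≡𝟙 a≤b) (sym 𝟘⇒𝟘≡𝟙))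

  isLEIA : IsLEIA E _⇒_ 𝟘
  isLEIA = record
    { i-a = λ x → valid (𝟘≤ x)
    ; i-b = λ x → valid ≤-refl
    ; i-c = λ x → from (⇒≡𝟘⇒𝟘⇔≤ refl 𝟘⇒𝟘≡𝟙) (≤𝟙 x)
    ; ii = λ x y p q → ≤-antisym (valid⁻¹ p) (valid⁻¹ q)
    ; iii = λ x y z p q → valid (≤-trans (valid⁻¹ p) (valid⁻¹ q))
    ; iv = λ x y p → from (⇒≡𝟘⇒𝟘⇔≤ (⇒𝟘 y) (⇒𝟘 x)) (′-antitone (valid⁻¹ p))
    ; v = λ x → trans (cong (_⇒ 𝟘) (⇒𝟘 x)) (trans (⇒𝟘 (x ′)) (′-involutive x))
    ; vi = λ x y → from (⇒≡𝟘⇒𝟘⇔≤ refl (⇒⇒≡∨ x y)) (∨-upperˡ x y)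
    ; vii = λ x y → from (⇒≡𝟘⇒𝟘⇔≤ refl (⇒⇒≡∨ x y)) (∨-upperʳ x y)
    ; viii = λ x y z p q → from (⇒≡𝟘⇒𝟘⇔≤ (⇒⇒≡∨ x y) refl) (∨-least x y z (valid⁻¹ p) (valid⁻¹ q))
    ; ix = λ x y p → trans (≤⇒⇒≡′⇒′ (valid⁻¹ p)) (sym (cong₂ _⇒_ (⇒𝟘 x) (⇒𝟘 y)))
    ; x-to = λ x y z (p , q) → map (from (orthogonal y z)) (from (orthogonal-sum x y z))
        (≤′-assocʳ (to (orthogonal x y) p) (to (sum-orthogonal x y z) q))
    ; x-from = λ x y z (p , q) → map (from (orthogonal x y)) (from (sum-orthogonal x y z))
        (≤′-assocˡ (to (orthogonal y z) p) (to (orthogonal-sum x y z) q))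
    ; x-eq = λ x y z (p , q) → begin
        (((x ⇒ 𝟘) ⇒ y) ⇒ 𝟘) ⇒ z   ≡⟨ cong (_⇒ z) (trans (⇒𝟘 _) (cong (λ t → (t ⇒ y) ′) (⇒𝟘 x))) ⟩
        (x ′ ⇒ y) ′ ⇒ z           ≡⟨ ⇒-assoc (to (orthogonal x y) p) (to (sum-orthogonal x y z) q) ⟩
        x ′ ⇒ (y ′ ⇒ z)           ≡⟨ cong₂ _⇒_ (⇒𝟘 x) (cong (_⇒ z) (⇒𝟘 y)) ⟨
        (x ⇒ 𝟘) ⇒ ((y ⇒ 𝟘) ⇒ z)  ∎
    ; xi = λ x y → trans (cong₂ _⇒_ (⇒𝟘 y) (trans (cong (_⇒ 𝟘) (⇒⇒≡∨ x y)) (⇒𝟘 (x ∨ y))))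
                         (≡just-unique (≤′⇒⊕≡⇒ (⊥⇒≤′ (_ , ⇒-sum x y))) (⇒-sum x y))
    ; xii = λ x y → valid (_ , ⇒-sum y x)
    }
    where
    open ≡-Reasoning
    open Equivalence

    valid : x ≤ y → x ⇒ y ≡ 𝟘 ⇒ 𝟘
    valid = from (⇒≡𝟘⇒𝟘⇔≤ refl refl)

    valid⁻¹ : x ⇒ y ≡ 𝟘 ⇒ 𝟘 → x ≤ y
    valid⁻¹ = to (⇒≡𝟘⇒𝟘⇔≤ refl refl)

    orthogonal : ∀ x y → (x ⇒ (y ⇒ 𝟘) ≡ 𝟘 ⇒ 𝟘) ⇔ (x ≤ (y ′))
    orthogonal x y = ⇒≡𝟘⇒𝟘⇔≤ refl (⇒𝟘 y)

    sum-orthogonal : ∀ x y z → (((x ⇒ 𝟘) ⇒ y) ⇒ (z ⇒ 𝟘) ≡ 𝟘 ⇒ 𝟘) ⇔ ((x ′ ⇒ y) ≤ (z ′))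
    sum-orthogonal x y z = ⇒≡𝟘⇒𝟘⇔≤ (cong (_⇒ y) (⇒𝟘 x)) (⇒𝟘 z)

    orthogonal-sum : ∀ x y z → (x ⇒ (((y ⇒ 𝟘) ⇒ z) ⇒ 𝟘) ≡ 𝟘 ⇒ 𝟘) ⇔ (x ≤ ((y ′ ⇒ z) ′))
    orthogonal-sum x y z = ⇒≡𝟘⇒𝟘⇔≤ refl (trans (⇒𝟘 _) (cong (λ t → (t ⇒ z) ′) (⇒𝟘 y)))

theorem2p4 : (L : LatticeEffectAlgebra) →
    let open LatticeEffectAlgebra L in
    Σ (E → E → E) λ _⇒_ →
      (∀ x y → y ⊕ ((x ∨ y) ′) ≡ just (x ⇒ y))
      × IsLEIA E _⇒_ 𝟘
      × (∀ x y → (x ≤ y) ⇔ (x ⇒ y ≡ 𝟙))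
      × (∀ x y → x ∨ y ≡ (x ⇒ y) ⇒ y)
      × (∀ x y → x ∧ y ≡ ((x ′) ∨ (y ′)) ′)
theorem2p4 L =
    _⇒_
  , ⇒-sum
  , isLEIA
  , (λ x y → mk⇔ ≤⇒⇒≡𝟙 ⇒≡𝟙⇒≤)
  , (λ x y → sym (⇒⇒≡∨ x y))
  , ∧≡′∨′
  where open LatticeEffectAlgebraProperties L
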